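{- Let $G = K_{n_1,n_2,\ldots,n_m}$ be a complete $m$-partite graph and let $n \ge 1$. Then the join $G + K_n$ is $A$-vertex magic for every Abelian group $A$ with $|A|>2$.
   Context: For a non-trivial Abelian group $A$, a graph $G$ is $A$-vertex magic if there exist a labeling $l : V(G) \to A\setminus\{0\}$ and $\mu \in A$ such that $\sum_{u \in N_G(v)} l(u) = \mu$ for every $v \in V(G)$, where $N_G(v)$ is the open neighborhood of $v$. The join $G+K_n$ is obtained from the disjoint union of $G$ and the complete graph $K_n$ by adding all edges between $V(G)$ and $V(K_n)$. -}

module Defs where

open import Level using (Level; _⊔_; suc)
open import Data.Bool using (Bool; true; false; if_then_else_; not)
open import Data.Nat using (ℕ; _≥_; _>_)
open import Data.Fin using (Fin; _≟_)
open import Data.List using (List; map; foldr; _++_; concatMap; allFin)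
open import Data.Product using (Σ; _×_; _,_; ∃)
open import Data.Sum using (_⊎_; inj₁; inj₂)
open import Relation.Nullary using (¬_)
open import Relation.Nullary.Decidable using (⌊_⌋)
open import Algebra.Bundles using (AbelianGroup)

-- A finite simple graph: a vertex type, a Boolean adjacency relation,
-- and a list enumerating every vertex exactly once.
record Graph : Set₁ where
  field
    V     : Set
    adj   : V → V → Bool
    verts : List V
open Graph public

completeMultipartite : (m : ℕ) → (Fin m → ℕ) → Graph
completeMultipartite m sizes = record
  { V     = Σ (Fin m) (λ i → Fin (sizes i))
  ; adj   = λ { (i , _) (j , _) → not ⌊ i ≟ j ⌋ }
  ; verts = concatMap (λ i → map (i ,_) (allFin (sizes i))) (allFin m)
  }

join : Graph → ℕ → Graph
join G n = record
  { V     = V G ⊎ Fin n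
  ; adj   = adjJ
  ; verts = map inj₁ (verts G) ++ map inj₂ (allFin n)
  }
  where
  adjJ : V G ⊎ Fin n → V G ⊎ Fin n → Bool
  adjJ (inj₁ u) (inj₁ v) = adj G u v
  adjJ (inj₁ _) (inj₂ _) = true
  adjJ (inj₂ _) (inj₁ _) = true
  adjJ (inj₂ k) (inj₂ k') = not ⌊ k ≟ k' ⌋

module _ {c ℓ : Level} (A : AbelianGroup c ℓ) where
  open AbelianGroup A

  nbrSum : (G : Graph) → (V G → Carrier) → V G → Carrier
  nbrSum G l v = foldr (λ u acc → (if adj G v u then l u else ε) ∙ acc) ε (verts G)

  IsVertexMagic : Graph → Set (c ⊔ ℓ)
  IsVertexMagic G =
    Σ (V G → Carrier) λ l →
      (∀ v → ¬ (l v ≈ ε)) ×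
      Σ Carrier (λ μ → ∀ v → nbrSum G l v ≈ μ)

  HasMoreThanTwoElements : Set (c ⊔ ℓ)
  HasMoreThanTwoElements =
    Σ Carrier λ a → Σ Carrier λ b → Σ Carrier λ d →
      ¬ (a ≈ b) × ¬ (a ≈ d) × ¬ (b ≈ d)

-- Choose nonzero x ≠ c in A. Every part of size s ≥ 1 can be labelled by s nonzero
-- elements summing to c (c alone, or x, c − x, followed by cancelling pairs x, −x),
-- and every vertex of K_n is labelled c. A vertex of G then sees the other m − 1 parts
-- and K_n, a vertex of K_n sees all m parts and the other n − 1 vertices of K_n, so in
-- both cases the neighbourhood sum is (m + n − 1) · c.
module Submission where

open import Defs
open import Level using (Level)
open import Data.Bool using (Bool; true; false; if_then_else_; not)
open import Data.Nat using (ℕ; zero; suc; _+_; _≥_; s≤s; z≤n)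
open import Data.Nat.Properties using (+-suc)
open import Data.Fin using (Fin; zero; suc; _≟_; punchIn)
open import Data.List using (List; []; _∷_; map; foldr; _++_; concatMap; tabulate; allFin)
open import Data.Product using (Σ; _,_; uncurry)
open import Data.Sum using (inj₁; inj₂; [_,_]′)
open import Data.Vec.Functional using (removeAt)
open import Function using (_∘_; const)
open import Relation.Nullary using (¬_)
open import Relation.Nullary.Decidable using (⌊_⌋; isYes≗does)
open import Relation.Binary.PropositionalEquality as ≡ using (_≡_)
open import Algebra.Bundles using (AbelianGroup)
import Algebra.Properties.Group as GroupProperties
import Algebra.Properties.Monoid.Sum as MonoidSum
import Algebra.Properties.Monoid.Mult as MonoidMult
import Relation.Binary.Reasoning.Setoid as SetoidReasoning

⌊suc≟suc⌋ : {p : ℕ} (k i : Fin p) → ⌊ suc k ≟ suc i ⌋ ≡ ⌊ k ≟ i ⌋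
⌊suc≟suc⌋ k i = ≡.trans (isYes≗does (suc k ≟ suc i)) (≡.sym (isYes≗does (k ≟ i)))

module _ {ℓ₁ ℓ₂ : Level} (A : AbelianGroup ℓ₁ ℓ₂) where
  open AbelianGroup A
  open MonoidSum monoid using (sum; sum-cong-≋; sum-cong-≗; sum-replicate; sum-replicate-zero)
  open MonoidMult monoid using (_×_; ×-homo-+; ×-congˡ)
  open SetoidReasoning setoid

  sumBy : {X : Set} → (X → Carrier) → List X → Carrier
  sumBy f = foldr (λ u acc → f u ∙ acc) ε

  sumBy-++ : {X : Set} (f : X → Carrier) (xs ys : List X) →
             sumBy f (xs ++ ys) ≈ sumBy f xs ∙ sumBy f ys
  sumBy-++ f []       ys = sym (identityˡ _)
  sumBy-++ f (x ∷ xs) ys = trans (∙-congˡ (sumBy-++ f xs ys)) (sym (assoc _ _ _))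

  sumBy-map : {X Y : Set} (f : Y → Carrier) (g : X → Y) (xs : List X) →
              sumBy f (map g xs) ≡ sumBy (f ∘ g) xs
  sumBy-map f g []       = ≡.refl
  sumBy-map f g (x ∷ xs) = ≡.cong (f (g x) ∙_) (sumBy-map f g xs)

  sumBy-concatMap : {X Y : Set} (f : Y → Carrier) (g : X → List Y) (xs : List X) →
                    sumBy f (concatMap g xs) ≈ sumBy (sumBy f ∘ g) xs
  sumBy-concatMap f g []       = refl
  sumBy-concatMap f g (x ∷ xs) =
    trans (sumBy-++ f (g x) (concatMap g xs)) (∙-congˡ (sumBy-concatMap f g xs))

  sumBy-tabulate : {X : Set} {n : ℕ} (f : X → Carrier) (g : Fin n → X) →
                   sumBy f (tabulate g) ≡ sum (f ∘ g)
  sumBy-tabulate {n = zero}  f g = ≡.refl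
  sumBy-tabulate {n = suc n} f g = ≡.cong (f (g zero) ∙_) (sumBy-tabulate f (g ∘ suc))

  sumBy-allFin : {n : ℕ} (f : Fin n → Carrier) → sumBy f (allFin n) ≡ sum f
  sumBy-allFin f = sumBy-tabulate f (λ i → i)

  sum-if : {n : ℕ} (b : Bool) (f : Fin n → Carrier) →
           sum (λ j → if b then f j else ε) ≈ (if b then sum f else ε)
  sum-if     true  f = refl
  sum-if {n} false f = sum-replicate-zero n

  sum-if-≢ : {p : ℕ} (k : Fin (suc p)) (f : Fin (suc p) → Carrier) →
             sum (λ i → if not ⌊ k ≟ i ⌋ then f i else ε) ≈ sum (removeAt f k)
  sum-if-≢           zero    f = identityˡ _
  sum-if-≢ {suc p}   (suc k) f = ∙-congˡ (begin
    sum (λ i → if not ⌊ suc k ≟ suc i ⌋ then f (suc i) else ε)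
      ≡⟨ sum-cong-≗ (λ i → ≡.cong (λ b → if not b then f (suc i) else ε) (⌊suc≟suc⌋ k i)) ⟩
    sum (λ i → if not ⌊ k ≟ i ⌋ then f (suc i) else ε)
      ≈⟨ sum-if-≢ k (f ∘ suc) ⟩
    sum (removeAt (f ∘ suc) k) ∎)

  nbrSum-join-inj₁ : (G : Graph) (n : ℕ) (l : V (join G n) → Carrier) (u : V G) →
                     nbrSum A (join G n) l (inj₁ u) ≈ nbrSum A G (l ∘ inj₁) u ∙ sum (l ∘ inj₂)
  nbrSum-join-inj₁ G n l u = begin
    sumBy h (map inj₁ (verts G) ++ map inj₂ (allFin n))
      ≈⟨ sumBy-++ h (map inj₁ (verts G)) (map inj₂ (allFin n)) ⟩
    sumBy h (map inj₁ (verts G)) ∙ sumBy h (map inj₂ (allFin n))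
      ≡⟨ ≡.cong₂ _∙_ (sumBy-map h inj₁ (verts G))
                     (≡.trans (sumBy-map h inj₂ (allFin n)) (sumBy-allFin (l ∘ inj₂))) ⟩
    nbrSum A G (l ∘ inj₁) u ∙ sum (l ∘ inj₂) ∎
    where
    h : V (join G n) → Carrier
    h w = if adj (join G n) (inj₁ u) w then l w else ε

  nbrSum-join-inj₂ : (G : Graph) (n : ℕ) (l : V (join G n) → Carrier) (k : Fin n) →
                     nbrSum A (join G n) l (inj₂ k) ≈
                     sumBy (l ∘ inj₁) (verts G) ∙ sum (λ k′ → if not ⌊ k ≟ k′ ⌋ then l (inj₂ k′) else ε)
  nbrSum-join-inj₂ G n l k = begin
    sumBy h (map inj₁ (verts G) ++ map inj₂ (allFin n))
      ≈⟨ sumBy-++ h (map inj₁ (verts G)) (map inj₂ (allFin n)) ⟩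
    sumBy h (map inj₁ (verts G)) ∙ sumBy h (map inj₂ (allFin n))
      ≡⟨ ≡.cong₂ _∙_ (sumBy-map h inj₁ (verts G))
                     (≡.trans (sumBy-map h inj₂ (allFin n)) (sumBy-allFin (h ∘ inj₂))) ⟩
    sumBy (l ∘ inj₁) (verts G) ∙ sum (h ∘ inj₂) ∎
    where
    h : V (join G n) → Carrier
    h w = if adj (join G n) (inj₂ k) w then l w else ε

  sumBy-completeMultipartite : (m : ℕ) (sizes : Fin m → ℕ) (f : V (completeMultipartite m sizes) → Carrier) →
                               sumBy f (verts (completeMultipartite m sizes)) ≈ sum (λ i → sum (λ j → f (i , j)))
  sumBy-completeMultipartite m sizes f = begin
    sumBy f (concatMap part (allFin m))   ≈⟨ sumBy-concatMap f part (allFin m) ⟩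
    sumBy (sumBy f ∘ part) (allFin m)     ≡⟨ sumBy-allFin (sumBy f ∘ part) ⟩
    sum (sumBy f ∘ part)                  ≈⟨ sum-cong-≋ (λ i → reflexive (sumOverPart i)) ⟩
    sum (λ i → sum (λ j → f (i , j)))     ∎
    where
    part : (i : Fin m) → List (V (completeMultipartite m sizes))
    part i = map (i ,_) (allFin (sizes i))
    sumOverPart : (i : Fin m) → sumBy f (part i) ≡ sum (λ j → f (i , j))
    sumOverPart i = ≡.trans (sumBy-map f (i ,_) (allFin (sizes i))) (sumBy-allFin (λ j → f (i , j)))

  nbrSum-completeMultipartite : (p : ℕ) (sizes : Fin (suc p) → ℕ)
                                (l : V (completeMultipartite (suc p) sizes) → Carrier) (i : Fin (suc p)) (j : Fin (sizes i)) →
                                nbrSum A (completeMultipartite (suc p) sizes) l (i , j) ≈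
                                sum (removeAt (λ i′ → sum (λ j′ → l (i′ , j′))) i)
  nbrSum-completeMultipartite p sizes l i j = begin
    nbrSum A (completeMultipartite (suc p) sizes) l (i , j)
      ≈⟨ sumBy-completeMultipartite (suc p) sizes _ ⟩
    sum (λ i′ → sum (λ j′ → if not ⌊ i ≟ i′ ⌋ then l (i′ , j′) else ε))
      ≈⟨ sum-cong-≋ (λ i′ → sum-if (not ⌊ i ≟ i′ ⌋) (λ j′ → l (i′ , j′))) ⟩
    sum (λ i′ → if not ⌊ i ≟ i′ ⌋ then sum (λ j′ → l (i′ , j′)) else ε)
      ≈⟨ sum-if-≢ i (λ i′ → sum (λ j′ → l (i′ , j′))) ⟩
    sum (removeAt (λ i′ → sum (λ j′ → l (i′ , j′))) i) ∎

  nbrSum-join-completeMultipartite :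
    (p : ℕ) (sizes : Fin (suc p) → ℕ) (q : ℕ)
    (part : (i : Fin (suc p)) → Fin (sizes i) → Carrier) (c : Carrier) →
    (∀ i → sum (part i) ≈ c) →
    ∀ v → nbrSum A (join (completeMultipartite (suc p) sizes) (suc q)) [ uncurry part , const c ]′ v ≈ (p + suc q) × c
  nbrSum-join-completeMultipartite p sizes q part c partSum (inj₁ (i , j)) = begin
    nbrSum A (join G (suc q)) l (inj₁ (i , j))
      ≈⟨ nbrSum-join-inj₁ G (suc q) l (i , j) ⟩
    nbrSum A G (uncurry part) (i , j) ∙ sum {suc q} (const c)
      ≈⟨ ∙-congʳ (nbrSum-completeMultipartite p sizes (uncurry part) i j) ⟩
    sum (removeAt (sum ∘ part) i) ∙ sum {suc q} (const c)
      ≈⟨ ∙-cong (sum-cong-≋ (partSum ∘ punchIn i)) (sum-replicate (suc q)) ⟩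
    sum {p} (const c) ∙ suc q × c
      ≈⟨ ∙-congʳ (sum-replicate p) ⟩
    p × c ∙ suc q × c
      ≈⟨ ×-homo-+ c p (suc q) ⟨
    (p + suc q) × c ∎
    where
    G : Graph
    G = completeMultipartite (suc p) sizes
    l : V (join G (suc q)) → Carrier
    l = [ uncurry part , const c ]′
  nbrSum-join-completeMultipartite p sizes q part c partSum (inj₂ k) = begin
    nbrSum A (join G (suc q)) l (inj₂ k)
      ≈⟨ nbrSum-join-inj₂ G (suc q) l k ⟩
    sumBy (uncurry part) (verts G) ∙ sum (λ k′ → if not ⌊ k ≟ k′ ⌋ then c else ε)
      ≈⟨ ∙-cong (sumBy-completeMultipartite (suc p) sizes (uncurry part)) (sum-if-≢ k (const c)) ⟩
    sum (sum ∘ part) ∙ sum {q} (const c)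
      ≈⟨ ∙-congʳ (sum-cong-≋ partSum) ⟩
    sum {suc p} (const c) ∙ sum {q} (const c)
      ≈⟨ ∙-cong (sum-replicate (suc p)) (sum-replicate q) ⟩
    suc p × c ∙ q × c
      ≈⟨ ×-homo-+ c (suc p) q ⟨
    (suc p + q) × c
      ≈⟨ ×-congˡ (≡.sym (+-suc p q)) ⟩
    (p + suc q) × c ∎
    where
    G : Graph
    G = completeMultipartite (suc p) sizes
    l : V (join G (suc q)) → Carrier
    l = [ uncurry part , const c ]′

  module _ (x c : Carrier) where
    open GroupProperties group using (x∙y⁻¹≈ε⇒x≈y; ⁻¹-injective; ε⁻¹≈ε)

    decompose : (s : ℕ) → Fin s → Carrier
    decompose (suc zero)          zero          = c
    decompose (suc (suc zero))    zero          = x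
    decompose (suc (suc zero))    (suc zero)    = c ∙ x ⁻¹
    decompose (suc (suc (suc s))) zero          = x
    decompose (suc (suc (suc s))) (suc zero)    = x ⁻¹
    decompose (suc (suc (suc s))) (suc (suc j)) = decompose (suc s) j

    sum-decompose : (s : ℕ) → s ≥ 1 → sum (decompose s) ≈ c
    sum-decompose (suc zero)          _         = identityʳ c
    sum-decompose (suc (suc zero))    _         = begin
      x ∙ ((c ∙ x ⁻¹) ∙ ε)  ≈⟨ ∙-congˡ (trans (identityʳ _) (comm c (x ⁻¹))) ⟩
      x ∙ (x ⁻¹ ∙ c)        ≈⟨ assoc x (x ⁻¹) c ⟨
      (x ∙ x ⁻¹) ∙ c        ≈⟨ ∙-congʳ (inverseʳ x) ⟩
      ε ∙ c                 ≈⟨ identityˡ c ⟩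
      c                     ∎
    sum-decompose (suc (suc (suc s))) _         = begin
      x ∙ (x ⁻¹ ∙ sum (decompose (suc s)))  ≈⟨ assoc x (x ⁻¹) _ ⟨
      (x ∙ x ⁻¹) ∙ sum (decompose (suc s))  ≈⟨ ∙-cong (inverseʳ x) (sum-decompose (suc s) (s≤s z≤n)) ⟩
      ε ∙ c                                 ≈⟨ identityˡ c ⟩
      c                                     ∎

    decompose-nonzero : ¬ x ≈ ε → ¬ c ≈ ε → ¬ x ≈ c → (s : ℕ) (j : Fin s) → ¬ decompose s j ≈ ε
    decompose-nonzero x≉ε c≉ε x≉c (suc zero)          zero          = c≉ε
    decompose-nonzero x≉ε c≉ε x≉c (suc (suc zero))    zero          = x≉ε
    decompose-nonzero x≉ε c≉ε x≉c (suc (suc zero))    (suc zero)    = x≉c ∘ sym ∘ x∙y⁻¹≈ε⇒x≈y c x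
    decompose-nonzero x≉ε c≉ε x≉c (suc (suc (suc s))) zero          = x≉ε
    decompose-nonzero x≉ε c≉ε x≉c (suc (suc (suc s))) (suc zero)    = λ x⁻¹≈ε →
      x≉ε (⁻¹-injective (trans x⁻¹≈ε (sym ε⁻¹≈ε)))
    decompose-nonzero x≉ε c≉ε x≉c (suc (suc (suc s))) (suc (suc j)) = decompose-nonzero x≉ε c≉ε x≉c (suc s) j

module _ {ℓ₁ ℓ₂ : Level} (A : AbelianGroup ℓ₁ ℓ₂) where
  open AbelianGroup A
  open GroupProperties group using (x∙y⁻¹≈ε⇒x≈y; ∙-cancelˡ; ⁻¹-injective)
  open import Data.Product using (_×_)

  distinctNonzeroPair : HasMoreThanTwoElements A → Σ Carrier λ x → Σ Carrier λ y → ¬ x ≈ ε × ¬ y ≈ ε × ¬ x ≈ y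
  distinctNonzeroPair (a , b , d , a≉b , a≉d , b≉d) =
    a ∙ b ⁻¹ , a ∙ d ⁻¹ ,
    a≉b ∘ x∙y⁻¹≈ε⇒x≈y a b ,
    a≉d ∘ x∙y⁻¹≈ε⇒x≈y a d ,
    b≉d ∘ ⁻¹-injective ∘ ∙-cancelˡ a (b ⁻¹) (d ⁻¹)

mainTheorem5 : (m : ℕ) → m ≥ 1 → (sizes : Fin m → ℕ) → (∀ i → sizes i ≥ 1) →
    (n : ℕ) → n ≥ 1 →
    ∀ {c ℓ : Level} (A : AbelianGroup c ℓ) → HasMoreThanTwoElements A →
    IsVertexMagic A (join (completeMultipartite m sizes) n)
mainTheorem5 (suc p) _ sizes sizes≥1 (suc q) _ A moreThanTwo
  with distinctNonzeroPair A moreThanTwo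
... | x , c , x≉ε , c≉ε , x≉c =
  [ uncurry part , const c ]′ , nonzero , _ ,
  nbrSum-join-completeMultipartite A p sizes q part c (λ i → sum-decompose A x c (sizes i) (sizes≥1 i))
  where
  open AbelianGroup A using (Carrier; _≈_; ε)
  part : (i : Fin (suc p)) → Fin (sizes i) → Carrier
  part i = decompose A x c (sizes i)
  nonzero : ∀ v → ¬ [ uncurry part , const c ]′ v ≈ ε
  nonzero (inj₁ (i , j)) = decompose-nonzero A x c x≉ε c≉ε x≉c (sizes i) j
  nonzero (inj₂ _)       = c≉ε
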